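{- Let $\Gamma, \Delta_1, \Delta_2$ be multisets of formulae, such that $\Delta_1$ does not contain any negated formula. Let $D$ be at most one formula. If the sequent $\Gamma^p, \lrcorner \Delta_1^n, \neg \Delta_2^n \vdash D^n$ is provable in the intuitionistic sequent calculus, then $\Gamma \vdash \Delta_1, \Delta_2, D$ is provable in the classical sequent calculus.
   Context: First-order logic with connectives $\wedge,\vee,\Rightarrow,\neg$ and quantifiers $\forall,\exists$. The classical sequent calculus is the usual cut-free multi-conclusion sequent calculus (sequents $\Gamma\vdash\Delta$ of multisets, axiom $\Gamma,A\vdash A,\Delta$, left/right rules for each connective and quantifier, contraction and weakening on both sides, no cut). The intuitionistic sequent calculus is its cut-free restriction where the right-hand side contains at most one formula. The antinegation operator $\lrcorner$ (not a connective) is defined by: $\lrcorner A = B$ if $A$ is $\neg B$, and $\lrcorner A=\neg A$ otherwise. The polarized Gödel–Gentzen translations are defined by induction: for $A$ atomic, $A^p\equiv A$ and $A^n\equiv\neg\neg A$; $(A\wedge B)^p\equiv A^p\wedge B^p$, $(A\wedge B)^n\equiv A^n\wedge B^n$; $(A\vee B)^p\equiv A^p\vee B^p$, $(A\vee B)^n\equiv\neg(\neg A^n\wedge\neg B^n)$; $(A\Rightarrow B)^p\equiv A^n\Rightarrow B^p$, $(A\Rightarrow B)^n\equiv A^p\Rightarrow B^n$; $(\neg A)^p\equiv\neg A^n$, $(\neg A)^n\equiv\neg A^p$; $(\forall x A)^p\equiv\forall x A^p$, $(\forall x A)^n\equiv\forall x A^n$; $(\exists x A)^p\equiv\exists x A^p$,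 $(\exists x A)^n\equiv\neg\forall x\neg A^n$. Translations, $\neg$ and $\lrcorner$ on multisets are applied formula by formula; if $D$ is empty, $D^n$ is empty. -}

module Defs where

open import Data.Nat using (ℕ; zero; suc)
open import Data.List using (List; []; _∷_; _++_; map)
open import Data.Maybe using (Maybe; just; nothing)
open import Data.Empty using (⊥)
open import Data.Unit using (⊤)
open import Data.List.Relation.Binary.Permutation.Propositional using (_↭_)

-- First-order syntax (de Bruijn indices for bound variables).
-- Signature: countably many function symbols and predicate symbols
-- (named by ℕ), each applied to a list of arguments.

data Term : Set where
  var : ℕ → Term
  fun : ℕ → List Term → Term

data Formula : Set where
  atom : ℕ → List Term → Formula
  _∧'_ : Formula → Formula → Formula
  _∨'_ : Formula → Formula → Formula
  _⇒'_ : Formula → Formula → Formula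
  ¬'_  : Formula → Formula
  ∀'   : Formula → Formula
  ∃'   : Formula → Formula

infixr 6 _∧'_
infixr 5 _∨'_
infixr 4 _⇒'_
infix 7 ¬'_

Subst : Set
Subst = ℕ → Term

mutual
  substT : Subst → Term → Term
  substT σ (var x)    = σ x
  substT σ (fun f ts) = fun f (substTs σ ts)

  substTs : Subst → List Term → List Term
  substTs σ []       = []
  substTs σ (t ∷ ts) = substT σ t ∷ substTs σ ts

shiftS : Subst
shiftS x = var (suc x)

liftS : Subst → Subst
liftS σ zero    = var zero
liftS σ (suc x) = substT shiftS (σ x)

substF : Subst → Formula → Formula
substF σ (atom P ts) = atom P (substTs σ ts)
substF σ (A ∧' B)    = substF σ A ∧' substF σ B
substF σ (A ∨' B)    = substF σ A ∨' substF σ B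
substF σ (A ⇒' B)    = substF σ A ⇒' substF σ B
substF σ (¬' A)      = ¬' substF σ A
substF σ (∀' A)      = ∀' (substF (liftS σ) A)
substF σ (∃' A)      = ∃' (substF (liftS σ) A)

-- ↑ A : shift free variables of A (used for eigenvariable rules)
↑ : Formula → Formula
↑ = substF shiftS

↑s : List Formula → List Formula
↑s = map ↑

single : Term → Subst
single t zero    = t
single t (suc x) = var x

_[_] : Formula → Term → Formula
A [ t ] = substF (single t) A

-- Classical cut-free sequent calculus LK (multisets as lists + exchange)

infix 3 _⊢K_
data _⊢K_ : List Formula → List Formula → Set where
  ax    : ∀ {Γ Δ A} → A ∷ Γ ⊢K A ∷ Δ
  exch  : ∀ {Γ Γ' Δ Δ'} → Γ ↭ Γ' → Δ ↭ Δ' → Γ ⊢K Δ → Γ' ⊢K Δ'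
  contrL : ∀ {Γ Δ A} → A ∷ A ∷ Γ ⊢K Δ → A ∷ Γ ⊢K Δ
  contrR : ∀ {Γ Δ A} → Γ ⊢K A ∷ A ∷ Δ → Γ ⊢K A ∷ Δ
  weakL : ∀ {Γ Δ A} → Γ ⊢K Δ → A ∷ Γ ⊢K Δ
  weakR : ∀ {Γ Δ A} → Γ ⊢K Δ → Γ ⊢K A ∷ Δ
  ∧L    : ∀ {Γ Δ A B} → A ∷ B ∷ Γ ⊢K Δ → (A ∧' B) ∷ Γ ⊢K Δ
  ∧R    : ∀ {Γ Δ A B} → Γ ⊢K A ∷ Δ → Γ ⊢K B ∷ Δ → Γ ⊢K (A ∧' B) ∷ Δ
  ∨L    : ∀ {Γ Δ A B} → A ∷ Γ ⊢K Δ → B ∷ Γ ⊢K Δ → (A ∨' B) ∷ Γ ⊢K Δ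
  ∨R    : ∀ {Γ Δ A B} → Γ ⊢K A ∷ B ∷ Δ → Γ ⊢K (A ∨' B) ∷ Δ
  ⇒L    : ∀ {Γ Δ A B} → Γ ⊢K A ∷ Δ → B ∷ Γ ⊢K Δ → (A ⇒' B) ∷ Γ ⊢K Δ
  ⇒R    : ∀ {Γ Δ A B} → A ∷ Γ ⊢K B ∷ Δ → Γ ⊢K (A ⇒' B) ∷ Δ
  ¬L    : ∀ {Γ Δ A} → Γ ⊢K A ∷ Δ → (¬' A) ∷ Γ ⊢K Δ
  ¬R    : ∀ {Γ Δ A} → A ∷ Γ ⊢K Δ → Γ ⊢K (¬' A) ∷ Δ
  ∀L    : ∀ {Γ Δ A} (t : Term) → (A [ t ]) ∷ Γ ⊢K Δ → ∀' A ∷ Γ ⊢K Δ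
  ∀R    : ∀ {Γ Δ A} → ↑s Γ ⊢K A ∷ ↑s Δ → Γ ⊢K ∀' A ∷ Δ
  ∃L    : ∀ {Γ Δ A} → A ∷ ↑s Γ ⊢K ↑s Δ → ∃' A ∷ Γ ⊢K Δ
  ∃R    : ∀ {Γ Δ A} (t : Term) → Γ ⊢K (A [ t ]) ∷ Δ → Γ ⊢K ∃' A ∷ Δ

↑m : Maybe Formula → Maybe Formula
↑m nothing  = nothing
↑m (just A) = just (↑ A)

infix 3 _⊢J_
data _⊢J_ : List Formula → Maybe Formula → Set where
  ax    : ∀ {Γ A} → A ∷ Γ ⊢J just A
  exch  : ∀ {Γ Γ' D} → Γ ↭ Γ' → Γ ⊢J D → Γ' ⊢J D
  contrL : ∀ {Γ D A} → A ∷ A ∷ Γ ⊢J D → A ∷ Γ ⊢J D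
  weakL : ∀ {Γ D A} → Γ ⊢J D → A ∷ Γ ⊢J D
  weakR : ∀ {Γ A} → Γ ⊢J nothing → Γ ⊢J just A
  ∧L    : ∀ {Γ D A B} → A ∷ B ∷ Γ ⊢J D → (A ∧' B) ∷ Γ ⊢J D
  ∧R    : ∀ {Γ A B} → Γ ⊢J just A → Γ ⊢J just B → Γ ⊢J just (A ∧' B)
  ∨L    : ∀ {Γ D A B} → A ∷ Γ ⊢J D → B ∷ Γ ⊢J D → (A ∨' B) ∷ Γ ⊢J D
  ∨R₁   : ∀ {Γ A B} → Γ ⊢J just A → Γ ⊢J just (A ∨' B)
  ∨R₂   : ∀ {Γ A B} → Γ ⊢J just B → Γ ⊢J just (A ∨' B)
  ⇒L    : ∀ {Γ D A B} → Γ ⊢J just A → B ∷ Γ ⊢J D → (A ⇒' B) ∷ Γ ⊢J D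
  ⇒R    : ∀ {Γ A B} → A ∷ Γ ⊢J just B → Γ ⊢J just (A ⇒' B)
  ¬L    : ∀ {Γ A} → Γ ⊢J just A → (¬' A) ∷ Γ ⊢J nothing
  ¬R    : ∀ {Γ A} → A ∷ Γ ⊢J nothing → Γ ⊢J just (¬' A)
  ∀L    : ∀ {Γ D A} (t : Term) → (A [ t ]) ∷ Γ ⊢J D → ∀' A ∷ Γ ⊢J D
  ∀R    : ∀ {Γ A} → ↑s Γ ⊢J just A → Γ ⊢J just (∀' A)
  ∃L    : ∀ {Γ D A} → A ∷ ↑s Γ ⊢J ↑m D → ∃' A ∷ Γ ⊢J D
  ∃R    : ∀ {Γ A} (t : Term) → Γ ⊢J just (A [ t ]) → Γ ⊢J just (∃' A)

antineg : Formula → Formula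
antineg (¬' B) = B
antineg A      = ¬' A

IsNeg : Formula → Set
IsNeg (¬' _) = ⊤
IsNeg _      = ⊥

mutual
  _ᵖ : Formula → Formula
  atom P ts ᵖ = atom P ts
  (A ∧' B) ᵖ  = (A ᵖ) ∧' (B ᵖ)
  (A ∨' B) ᵖ  = (A ᵖ) ∨' (B ᵖ)
  (A ⇒' B) ᵖ  = (A ⁿ) ⇒' (B ᵖ)
  (¬' A) ᵖ    = ¬' (A ⁿ)
  (∀' A) ᵖ    = ∀' (A ᵖ)
  (∃' A) ᵖ    = ∃' (A ᵖ)

  _ⁿ : Formula → Formula
  atom P ts ⁿ = ¬' ¬' atom P ts
  (A ∧' B) ⁿ  = (A ⁿ) ∧' (B ⁿ)
  (A ∨' B) ⁿ  = ¬' ((¬' (A ⁿ)) ∧' (¬' (B ⁿ)))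
  (A ⇒' B) ⁿ  = (A ᵖ) ⇒' (B ⁿ)
  (¬' A) ⁿ    = ¬' (A ᵖ)
  (∀' A) ⁿ    = ∀' (A ⁿ)
  (∃' A) ⁿ    = ¬' ∀' (¬' (A ⁿ))

infix 9 _ᵖ _ⁿ

_ᵖˢ : List Formula → List Formula
Γ ᵖˢ = map _ᵖ Γ

_ⁿˢ : List Formula → List Formula
Γ ⁿˢ = map _ⁿ Γ

⌟ˢ : List Formula → List Formula
⌟ˢ Γ = map antineg Γ

¬ˢ : List Formula → List Formula
¬ˢ Γ = map ¬'_ Γ

_ⁿᵐ : Maybe Formula → Maybe Formula
nothing ⁿᵐ = nothing
just A ⁿᵐ  = just (A ⁿ)

toList : Maybe Formula → List Formula
toList nothing  = []
toList (just A) = A ∷ []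

-- An LJ hypothesis F is read classically in one of two ways: either F is a
-- translation of a formula A, and stands for A on the left of the classical
-- sequent, or F is a refutation of A, and stands for A on the right.  Likewise
-- the LJ conclusion is empty, translates a formula (read on the right) or refutes
-- one (read on the left).  Both notions are inductive relations between
-- formulas, closed under substitution, and chosen so that every LJ rule becomes a
-- (possibly empty) combination of LK rules on the classical reading.
module Submission where

open import Defs
open import Data.Nat using (zero; suc)
open import Data.List using (List; []; _∷_; _++_)
open import Data.List.Properties using (map-++; ++-assoc)
open import Data.Maybe using (Maybe; just; nothing)
open import Data.Product using (Σ-syntax; _×_; _,_)
open import Data.Unit using (tt)
open import Data.Empty using (⊥-elim)
open import Data.List.Relation.Unary.All using (All; []; _∷_)
open import Relation.Nullary using (¬_)
open import Relation.Binary.PropositionalEquality as ≡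
  using (_≡_; _≗_; refl; sym; cong; cong₂; subst; subst₂)
open import Data.List.Relation.Binary.Permutation.Propositional
  using (_↭_; refl; prep; swap; trans; ↭-sym; ↭-reflexive)
open import Data.List.Relation.Binary.Permutation.Propositional.Properties
  using (shifts; ++⁺ˡ; ++-comm)

variable
  A B F A₁ A₂ B₁ B₂ F₁ F₂ : Formula
  Γ Δ Γ′ L R L′ R′ : List Formula
  D : Maybe Formula
  σ τ : Subst

_∘ˢ_ : Subst → Subst → Subst
(σ ∘ˢ τ) x = substT σ (τ x)

mutual
  substT-cong : σ ≗ τ → ∀ t → substT σ t ≡ substT τ t
  substT-cong e (var x)    = e x
  substT-cong e (fun f ts) = cong (fun f) (substTs-cong e ts)

  substTs-cong : σ ≗ τ → ∀ ts → substTs σ ts ≡ substTs τ ts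
  substTs-cong e []       = refl
  substTs-cong e (t ∷ ts) = cong₂ _∷_ (substT-cong e t) (substTs-cong e ts)

liftS-cong : σ ≗ τ → liftS σ ≗ liftS τ
liftS-cong e zero    = refl
liftS-cong e (suc x) = cong (substT shiftS) (e x)

substF-cong : σ ≗ τ → ∀ A → substF σ A ≡ substF τ A
substF-cong e (atom P ts) = cong (atom P) (substTs-cong e ts)
substF-cong e (A ∧' B)    = cong₂ _∧'_ (substF-cong e A) (substF-cong e B)
substF-cong e (A ∨' B)    = cong₂ _∨'_ (substF-cong e A) (substF-cong e B)
substF-cong e (A ⇒' B)    = cong₂ _⇒'_ (substF-cong e A) (substF-cong e B)
substF-cong e (¬' A)      = cong ¬'_ (substF-cong e A)
substF-cong e (∀' A)      = cong ∀' (substF-cong (liftS-cong e) A)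
substF-cong e (∃' A)      = cong ∃' (substF-cong (liftS-cong e) A)

mutual
  substT-∘ : ∀ σ τ t → substT σ (substT τ t) ≡ substT (σ ∘ˢ τ) t
  substT-∘ σ τ (var x)    = refl
  substT-∘ σ τ (fun f ts) = cong (fun f) (substTs-∘ σ τ ts)

  substTs-∘ : ∀ σ τ ts → substTs σ (substTs τ ts) ≡ substTs (σ ∘ˢ τ) ts
  substTs-∘ σ τ []       = refl
  substTs-∘ σ τ (t ∷ ts) = cong₂ _∷_ (substT-∘ σ τ t) (substTs-∘ σ τ ts)

liftS-∘ : ∀ σ τ → liftS σ ∘ˢ liftS τ ≗ liftS (σ ∘ˢ τ)
liftS-∘ σ τ zero    = refl
liftS-∘ σ τ (suc x) =
  ≡.trans (substT-∘ (liftS σ) shiftS (τ x)) (sym (substT-∘ shiftS σ (τ x)))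

substF-∘ : ∀ σ τ A → substF σ (substF τ A) ≡ substF (σ ∘ˢ τ) A
substF-∘ σ τ (atom P ts) = cong (atom P) (substTs-∘ σ τ ts)
substF-∘ σ τ (A ∧' B)    = cong₂ _∧'_ (substF-∘ σ τ A) (substF-∘ σ τ B)
substF-∘ σ τ (A ∨' B)    = cong₂ _∨'_ (substF-∘ σ τ A) (substF-∘ σ τ B)
substF-∘ σ τ (A ⇒' B)    = cong₂ _⇒'_ (substF-∘ σ τ A) (substF-∘ σ τ B)
substF-∘ σ τ (¬' A)      = cong ¬'_ (substF-∘ σ τ A)
substF-∘ σ τ (∀' A)      =
  cong ∀' (≡.trans (substF-∘ (liftS σ) (liftS τ) A) (substF-cong (liftS-∘ σ τ) A))
substF-∘ σ τ (∃' A)      =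
  cong ∃' (≡.trans (substF-∘ (liftS σ) (liftS τ) A) (substF-cong (liftS-∘ σ τ) A))

mutual
  substT-id : σ ≗ var → ∀ t → substT σ t ≡ t
  substT-id e (var x)    = e x
  substT-id e (fun f ts) = cong (fun f) (substTs-id e ts)

  substTs-id : σ ≗ var → ∀ ts → substTs σ ts ≡ ts
  substTs-id e []       = refl
  substTs-id e (t ∷ ts) = cong₂ _∷_ (substT-id e t) (substTs-id e ts)

liftS-id : σ ≗ var → liftS σ ≗ var
liftS-id e zero    = refl
liftS-id e (suc x) = cong (substT shiftS) (e x)

substF-id : σ ≗ var → ∀ A → substF σ A ≡ A
substF-id e (atom P ts) = cong (atom P) (substTs-id e ts)
substF-id e (A ∧' B)    = cong₂ _∧'_ (substF-id e A) (substF-id e B)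
substF-id e (A ∨' B)    = cong₂ _∨'_ (substF-id e A) (substF-id e B)
substF-id e (A ⇒' B)    = cong₂ _⇒'_ (substF-id e A) (substF-id e B)
substF-id e (¬' A)      = cong ¬'_ (substF-id e A)
substF-id e (∀' A)      = cong ∀' (substF-id (liftS-id e) A)
substF-id e (∃' A)      = cong ∃' (substF-id (liftS-id e) A)

-- The body of a shifted quantifier, instantiated with the fresh variable 0, is
-- the original body: this is how an eigenvariable is used after ∀R or ∃L.
instantiate-shifted : ∀ A → substF (liftS shiftS) A [ var zero ] ≡ A
instantiate-shifted A =
  ≡.trans (substF-∘ (single (var zero)) (liftS shiftS) A) (substF-id pointwise A)
  where
  pointwise : single (var zero) ∘ˢ liftS shiftS ≗ var
  pointwise zero    = refl
  pointwise (suc x) = refl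

swapL : A ∷ B ∷ Γ ⊢K Δ → B ∷ A ∷ Γ ⊢K Δ
swapL = exch (swap _ _ refl) refl

swapR : Γ ⊢K A ∷ B ∷ Δ → Γ ⊢K B ∷ A ∷ Δ
swapR = exch refl (swap _ _ refl)

-- ∀L and ∃R instantiated with the eigenvariable of an enclosing ∀R or ∃L.
∀L↑ : A ∷ Γ ⊢K Δ → ↑ (∀' A) ∷ Γ ⊢K Δ
∀L↑ {A = A} d =
  ∀L (var zero) (subst (λ X → X ∷ _ ⊢K _) (sym (instantiate-shifted A)) d)

∃R↑ : Γ ⊢K A ∷ Δ → Γ ⊢K ↑ (∃' A) ∷ Δ
∃R↑ {A = A} d =
  ∃R (var zero) (subst (λ X → _ ⊢K X ∷ _) (sym (instantiate-shifted A)) d)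

_⊩_ : Formula → Formula → Set
A ⊩ B = ∀ {Γ Δ} → A ∷ Γ ⊢K B ∷ Δ

∧-mono : A₁ ⊩ B₁ → A₂ ⊩ B₂ → (A₁ ∧' A₂) ⊩ (B₁ ∧' B₂)
∧-mono f g = ∧L (∧R f (weakL g))

∨-mono : A₁ ⊩ B₁ → A₂ ⊩ B₂ → (A₁ ∨' A₂) ⊩ (B₁ ∨' B₂)
∨-mono f g = ∨R (∨L f (weakR g))

⇒-mono : B₁ ⊩ A₁ → A₂ ⊩ B₂ → (A₁ ⇒' A₂) ⊩ (B₁ ⇒' B₂)
⇒-mono f g = ⇒R (swapL (⇒L f g))

¬-mono : B ⊩ A → (¬' A) ⊩ (¬' B)
¬-mono f = ¬R (swapL (¬L f))

∀-mono : A ⊩ B → (∀' A) ⊩ (∀' B)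
∀-mono f = ∀R (∀L↑ f)

∃-mono : A ⊩ B → (∃' A) ⊩ (∃' B)
∃-mono f = ∃L (∃R↑ f)

∨∧-clash : (∀ {Γ Δ} → B₁ ∷ A₁ ∷ Γ ⊢K Δ) → (∀ {Γ Δ} → B₂ ∷ A₂ ∷ Γ ⊢K Δ) →
           (B₁ ∨' B₂) ∷ (A₁ ∧' A₂) ∷ Γ ⊢K Δ
∨∧-clash f g =
  swapL (∧L (exch (trans (swap _ _ refl) (prep _ (swap _ _ refl))) refl
                  (∨L f (swapL (weakL g)))))

∧∨-excluded : (∀ {Γ Δ} → Γ ⊢K B₁ ∷ A₁ ∷ Δ) → (∀ {Γ Δ} → Γ ⊢K B₂ ∷ A₂ ∷ Δ) →
              Γ ⊢K (B₁ ∧' B₂) ∷ (A₁ ∨' A₂) ∷ Δ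
∧∨-excluded f g =
  swapR (∨R (exch refl (trans (swap _ _ refl) (prep _ (swap _ _ refl)))
                  (∧R f (swapR (weakR g)))))

mutual
  -- `Translation F A`: F is obtained from A by the polarized Gödel–Gentzen
  -- clauses, where each node may use either polarity and a double negation ¬G
  -- may translate A whenever G refutes A.
  data Translation : Formula → Formula → Set where
    tAtom : ∀ {P ts} → Translation (atom P ts) (atom P ts)
    t∧    : Translation F₁ A₁ → Translation F₂ A₂ → Translation (F₁ ∧' F₂) (A₁ ∧' A₂)
    t∨    : Translation F₁ A₁ → Translation F₂ A₂ → Translation (F₁ ∨' F₂) (A₁ ∨' A₂)
    t⇒    : Translation F₁ A₁ → Translation F₂ A₂ → Translation (F₁ ⇒' F₂) (A₁ ⇒' A₂)
    t¬    : Translation F A → Translation (¬' F) (¬' A)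
    t∀    : Translation F A → Translation (∀' F) (∀' A)
    t∃    : Translation F A → Translation (∃' F) (∃' A)
    t¬r   : Refutation F A → Translation (¬' F) A

  -- `Refutation F A`: F, as a hypothesis, expresses that A is false.
  data Refutation : Formula → Formula → Set where
    r¬   : Translation F A → Refutation (¬' F) A
    r¬∧¬ : Translation F₁ A₁ → Translation F₂ A₂ →
           Refutation ((¬' F₁) ∧' (¬' F₂)) (A₁ ∨' A₂)
    r∀¬  : Translation F A → Refutation (∀' (¬' F)) (∃' A)

mutual
  ᵖ-translation : ∀ A → Translation (A ᵖ) A
  ᵖ-translation (atom P ts) = tAtom
  ᵖ-translation (A ∧' B)    = t∧ (ᵖ-translation A) (ᵖ-translation B)
  ᵖ-translation (A ∨' B)    = t∨ (ᵖ-translation A) (ᵖ-translation B)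
  ᵖ-translation (A ⇒' B)    = t⇒ (ⁿ-translation A) (ᵖ-translation B)
  ᵖ-translation (¬' A)      = t¬ (ⁿ-translation A)
  ᵖ-translation (∀' A)      = t∀ (ᵖ-translation A)
  ᵖ-translation (∃' A)      = t∃ (ᵖ-translation A)

  ⁿ-translation : ∀ A → Translation (A ⁿ) A
  ⁿ-translation (atom P ts) = t¬r (r¬ tAtom)
  ⁿ-translation (A ∧' B)    = t∧ (ⁿ-translation A) (ⁿ-translation B)
  ⁿ-translation (A ∨' B)    = t¬r (r¬∧¬ (ⁿ-translation A) (ⁿ-translation B))
  ⁿ-translation (A ⇒' B)    = t⇒ (ᵖ-translation A) (ⁿ-translation B)
  ⁿ-translation (¬' A)      = t¬ (ᵖ-translation A)
  ⁿ-translation (∀' A)      = t∀ (ⁿ-translation A)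
  ⁿ-translation (∃' A)      = t¬r (r∀¬ (ⁿ-translation A))

antineg-refutation : ∀ A → ¬ IsNeg A → Refutation (antineg (A ⁿ)) A
antineg-refutation (atom P ts) _   = r¬ tAtom
antineg-refutation (A ∧' B)    _   = r¬ (ⁿ-translation (A ∧' B))
antineg-refutation (A ∨' B)    _   = r¬∧¬ (ⁿ-translation A) (ⁿ-translation B)
antineg-refutation (A ⇒' B)    _   = r¬ (ⁿ-translation (A ⇒' B))
antineg-refutation (¬' A)      neg = ⊥-elim (neg tt)
antineg-refutation (∀' A)      _   = r¬ (ⁿ-translation (∀' A))
antineg-refutation (∃' A)      _   = r∀¬ (ⁿ-translation A)

mutual
  translation-subst : ∀ σ → Translation F A → Translation (substF σ F) (substF σ A)
  translation-subst σ tAtom     = tAtom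
  translation-subst σ (t∧ a b)  = t∧ (translation-subst σ a) (translation-subst σ b)
  translation-subst σ (t∨ a b)  = t∨ (translation-subst σ a) (translation-subst σ b)
  translation-subst σ (t⇒ a b)  = t⇒ (translation-subst σ a) (translation-subst σ b)
  translation-subst σ (t¬ a)    = t¬ (translation-subst σ a)
  translation-subst σ (t∀ a)    = t∀ (translation-subst (liftS σ) a)
  translation-subst σ (t∃ a)    = t∃ (translation-subst (liftS σ) a)
  translation-subst σ (t¬r ρ)   = t¬r (refutation-subst σ ρ)

  refutation-subst : ∀ σ → Refutation F A → Refutation (substF σ F) (substF σ A)
  refutation-subst σ (r¬ a)     = r¬ (translation-subst σ a)
  refutation-subst σ (r¬∧¬ a b) = r¬∧¬ (translation-subst σ a) (translation-subst σ b)
  refutation-subst σ (r∀¬ a)    = r∀¬ (translation-subst (liftS σ) a)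

mutual
  same-translation : Translation F A → Translation F B → A ⊩ B
  same-translation tAtom       tAtom       = ax
  same-translation (t∧ a₁ a₂)  (t∧ b₁ b₂)  =
    ∧-mono (same-translation a₁ b₁) (same-translation a₂ b₂)
  same-translation (t∨ a₁ a₂)  (t∨ b₁ b₂)  =
    ∨-mono (same-translation a₁ b₁) (same-translation a₂ b₂)
  same-translation (t⇒ a₁ a₂)  (t⇒ b₁ b₂)  =
    ⇒-mono (same-translation b₁ a₁) (same-translation a₂ b₂)
  same-translation (t¬ a)      (t¬ b)      = ¬-mono (same-translation b a)
  same-translation (t∀ a)      (t∀ b)      = ∀-mono (same-translation a b)
  same-translation (t∃ a)      (t∃ b)      = ∃-mono (same-translation a b)
  same-translation (t¬ a)      (t¬r ρ)     = ¬L (excluded a ρ)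
  same-translation (t¬r ρ)     (t¬ b)      = ¬R (swapL (clash ρ b))
  same-translation (t¬r ρ)     (t¬r ρ′)    = same-refutation ρ ρ′

  same-refutation : Refutation F A → Refutation F B → A ⊩ B
  same-refutation (r¬ a)       (r¬ b)       = same-translation a b
  same-refutation (r¬∧¬ a₁ a₂) (r¬∧¬ b₁ b₂) =
    ∨-mono (same-translation a₁ b₁) (same-translation a₂ b₂)
  same-refutation (r∀¬ a)      (r∀¬ b)      = ∃-mono (same-translation a b)

  clash : Refutation F B → Translation F A → B ∷ A ∷ Γ ⊢K Δ
  clash (r¬ b)       a          = clash¬ b a
  clash (r¬∧¬ b₁ b₂) (t∧ a₁ a₂) = ∨∧-clash (clash¬ b₁ a₁) (clash¬ b₂ a₂)
  clash (r∀¬ b)      (t∀ a)     = ∃L (swapL (∀L↑ (swapL (clash¬ b a))))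

  clash¬ : Translation F B → Translation (¬' F) A → B ∷ A ∷ Γ ⊢K Δ
  clash¬ b (t¬ a)  = swapL (¬L (same-translation b a))
  clash¬ b (t¬r ρ) = swapL (clash ρ b)

  excluded : Translation F B → Refutation F A → Γ ⊢K B ∷ A ∷ Δ
  excluded b          (r¬ a)       = excluded¬ b a
  excluded (t∧ b₁ b₂) (r¬∧¬ a₁ a₂) = ∧∨-excluded (excluded¬ b₁ a₁) (excluded¬ b₂ a₂)
  excluded (t∀ b)     (r∀¬ a)      = ∀R (swapR (∃R↑ (swapR (excluded¬ b a))))

  excluded¬ : Translation (¬' F) B → Translation F A → Γ ⊢K B ∷ A ∷ Δ
  excluded¬ (t¬ b)  a = ¬R (same-translation b a)
  excluded¬ (t¬r ρ) a = swapR (excluded a ρ)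

data Hyps : List Formula → List Formula → List Formula → Set where
  []     : Hyps [] [] []
  assume : Translation F A → Hyps Γ L R → Hyps (F ∷ Γ) (A ∷ L) R
  deny   : Refutation F A → Hyps Γ L R → Hyps (F ∷ Γ) L (A ∷ R)

data Goal : Maybe Formula → List Formula → List Formula → Set where
  none   : Goal nothing [] []
  prove  : Translation F A → Goal (just F) [] (A ∷ [])
  refute : Refutation F A → Goal (just F) (A ∷ []) []

Sound : List Formula → Maybe Formula → Set
Sound Γ′ D = ∀ {L R Dl Dr} → Hyps Γ′ L R → Goal D Dl Dr → Dl ++ L ⊢K Dr ++ R

hyps-shift : Hyps Γ L R → Hyps (↑s Γ) (↑s L) (↑s R)
hyps-shift []            = []
hyps-shift (assume a hs) = assume (translation-subst shiftS a) (hyps-shift hs)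
hyps-shift (deny ρ hs)   = deny (refutation-subst shiftS ρ) (hyps-shift hs)

goal-shift : Goal D L R → Goal (↑m D) (↑s L) (↑s R)
goal-shift none       = none
goal-shift (prove a)  = prove (translation-subst shiftS a)
goal-shift (refute ρ) = refute (refutation-subst shiftS ρ)

hyps-permute : Γ ↭ Γ′ → Hyps Γ′ L′ R′ →
               Σ[ L ∈ List Formula ] Σ[ R ∈ List Formula ] Hyps Γ L R × L ↭ L′ × R ↭ R′
hyps-permute refl hs = _ , _ , hs , refl , refl
hyps-permute (prep _ p) (assume a hs) with hyps-permute p hs
... | _ , _ , hs′ , pl , pr = _ , _ , assume a hs′ , prep _ pl , pr
hyps-permute (prep _ p) (deny ρ hs) with hyps-permute p hs
... | _ , _ , hs′ , pl , pr = _ , _ , deny ρ hs′ , pl , prep _ pr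
hyps-permute (swap _ _ p) (assume a (assume b hs)) with hyps-permute p hs
... | _ , _ , hs′ , pl , pr = _ , _ , assume b (assume a hs′) , swap _ _ pl , pr
hyps-permute (swap _ _ p) (assume a (deny ρ hs)) with hyps-permute p hs
... | _ , _ , hs′ , pl , pr = _ , _ , deny ρ (assume a hs′) , prep _ pl , prep _ pr
hyps-permute (swap _ _ p) (deny ρ (assume a hs)) with hyps-permute p hs
... | _ , _ , hs′ , pl , pr = _ , _ , assume a (deny ρ hs′) , prep _ pl , prep _ pr
hyps-permute (swap _ _ p) (deny ρ (deny ρ′ hs)) with hyps-permute p hs
... | _ , _ , hs′ , pl , pr = _ , _ , deny ρ′ (deny ρ hs′) , pl , swap _ _ pr
hyps-permute (trans p q) hs with hyps-permute q hs
... | _ , _ , hs′ , pl , pr with hyps-permute p hs′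
... | _ , _ , hs″ , pl′ , pr′ = _ , _ , hs″ , trans pl′ pl , trans pr′ pr

-- The goal's reading precedes the hypotheses' on each side; these reorderings
-- expose the hypotheses' formulas Xs to an LK rule.
frontL : ∀ Dl Xs → Dl ++ Xs ++ L ⊢K Δ → Xs ++ Dl ++ L ⊢K Δ
frontL Dl Xs = exch (shifts Dl Xs) refl

backL : ∀ Dl Xs → Xs ++ Dl ++ L ⊢K Δ → Dl ++ Xs ++ L ⊢K Δ
backL Dl Xs = exch (↭-sym (shifts Dl Xs)) refl

frontR : ∀ Dr Xs → Γ ⊢K Dr ++ Xs ++ R → Γ ⊢K Xs ++ Dr ++ R
frontR Dr Xs = exch refl (shifts Dr Xs)

backR : ∀ Dr Xs → Γ ⊢K Xs ++ Dr ++ R → Γ ⊢K Dr ++ Xs ++ R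
backR Dr Xs = exch refl (↭-sym (shifts Dr Xs))

weaken : ∀ Dl Dr → L ⊢K A ∷ R → Dl ++ L ⊢K A ∷ Dr ++ R
weaken []       []       d = d
weaken (_ ∷ Dl) Dr       d = weakL (weaken Dl Dr d)
weaken []       (_ ∷ Dr) d = swapR (weakR (weaken [] Dr d))

sound-ax : Sound (F ∷ Γ) (just F)
sound-ax (assume a _) (prove b)   = same-translation a b
sound-ax (assume a _) (refute ρ)  = clash ρ a
sound-ax (deny ρ _)   (prove b)   = excluded b ρ
sound-ax (deny ρ _)   (refute ρ′) = same-refutation ρ′ ρ

sound-exch : Γ ↭ Γ′ → Sound Γ D → Sound Γ′ D
sound-exch p ih {Dl = Dl} {Dr} hs g with hyps-permute p hs
... | _ , _ , hs′ , pl , pr = exch (++⁺ˡ Dl pl) (++⁺ˡ Dr pr) (ih hs′ g)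

sound-contrL : Sound (F ∷ F ∷ Γ) D → Sound (F ∷ Γ) D
sound-contrL ih {Dl = Dl} (assume a hs) g =
  backL Dl (_ ∷ []) (contrL (frontL Dl (_ ∷ _ ∷ []) (ih (assume a (assume a hs)) g)))
sound-contrL ih {Dr = Dr} (deny ρ hs) g =
  backR Dr (_ ∷ []) (contrR (frontR Dr (_ ∷ _ ∷ []) (ih (deny ρ (deny ρ hs)) g)))

sound-weakL : Sound Γ D → Sound (F ∷ Γ) D
sound-weakL ih {Dl = Dl} (assume a hs) g = backL Dl (_ ∷ []) (weakL (ih hs g))
sound-weakL ih {Dr = Dr} (deny ρ hs)   g = backR Dr (_ ∷ []) (weakR (ih hs g))

sound-weakR : Sound Γ nothing → Sound Γ (just F)
sound-weakR ih hs (prove _)  = weakR (ih hs none)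
sound-weakR ih hs (refute _) = weakL (ih hs none)

-- A refuted conjunction ¬F₁ ∧ ¬F₂ is a disjunction on the right.
sound-∧L : Sound (F₁ ∷ F₂ ∷ Γ) D → Sound ((F₁ ∧' F₂) ∷ Γ) D
sound-∧L ih {Dl = Dl} (assume (t∧ a₁ a₂) hs) g =
  backL Dl (_ ∷ []) (∧L (frontL Dl (_ ∷ _ ∷ []) (ih (assume a₁ (assume a₂ hs)) g)))
sound-∧L ih {Dr = Dr} (deny (r¬∧¬ a₁ a₂) hs) g =
  backR Dr (_ ∷ []) (∨R (frontR Dr (_ ∷ _ ∷ []) (ih (deny (r¬ a₁) (deny (r¬ a₂) hs)) g)))

sound-∧R : Sound Γ (just F₁) → Sound Γ (just F₂) → Sound Γ (just (F₁ ∧' F₂))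
sound-∧R ih₁ ih₂ hs (prove (t∧ a₁ a₂))    = ∧R (ih₁ hs (prove a₁)) (ih₂ hs (prove a₂))
sound-∧R ih₁ ih₂ hs (refute (r¬∧¬ a₁ a₂)) =
  ∨L (ih₁ hs (refute (r¬ a₁))) (ih₂ hs (refute (r¬ a₂)))

sound-∨L : Sound (F₁ ∷ Γ) D → Sound (F₂ ∷ Γ) D → Sound ((F₁ ∨' F₂) ∷ Γ) D
sound-∨L ih₁ ih₂ {Dl = Dl} (assume (t∨ a₁ a₂) hs) g =
  backL Dl (_ ∷ []) (∨L (frontL Dl (_ ∷ []) (ih₁ (assume a₁ hs) g))
                        (frontL Dl (_ ∷ []) (ih₂ (assume a₂ hs) g)))

sound-∨R₁ : Sound Γ (just F₁) → Sound Γ (just (F₁ ∨' F₂))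
sound-∨R₁ ih hs (prove (t∨ a₁ _)) = ∨R (swapR (weakR (ih hs (prove a₁))))

sound-∨R₂ : Sound Γ (just F₂) → Sound Γ (just (F₁ ∨' F₂))
sound-∨R₂ ih hs (prove (t∨ _ a₂)) = ∨R (weakR (ih hs (prove a₂)))

sound-⇒L : Sound Γ (just F₁) → Sound (F₂ ∷ Γ) D → Sound ((F₁ ⇒' F₂) ∷ Γ) D
sound-⇒L ih₁ ih₂ {Dl = Dl} {Dr} (assume (t⇒ a₁ a₂) hs) g =
  backL Dl (_ ∷ []) (⇒L (weaken Dl Dr (ih₁ hs (prove a₁)))
                        (frontL Dl (_ ∷ []) (ih₂ (assume a₂ hs) g)))

sound-⇒R : Sound (F₁ ∷ Γ) (just F₂) → Sound Γ (just (F₁ ⇒' F₂))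
sound-⇒R ih hs (prove (t⇒ a₁ a₂)) = ⇒R (ih (assume a₁ hs) (prove a₂))

-- The negation rules mostly just move a formula across the sequent: they only
-- produce an LK rule when the negation is read as a classical negation.
sound-¬L : Sound Γ (just F) → Sound ((¬' F) ∷ Γ) nothing
sound-¬L ih (assume (t¬ a) hs)  none = ¬L (ih hs (prove a))
sound-¬L ih (assume (t¬r ρ) hs) none = ih hs (refute ρ)
sound-¬L ih (deny (r¬ a) hs)    none = ih hs (prove a)

sound-¬R : Sound (F ∷ Γ) nothing → Sound Γ (just (¬' F))
sound-¬R ih hs (prove (t¬ a))  = ¬R (ih (assume a hs) none)
sound-¬R ih hs (prove (t¬r ρ)) = ih (deny ρ hs) none
sound-¬R ih hs (refute (r¬ a)) = ih (assume a hs) none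

-- A refuted universal ∀¬F is an existential on the right.
sound-∀L : ∀ t → Sound ((F [ t ]) ∷ Γ) D → Sound (∀' F ∷ Γ) D
sound-∀L t ih {Dl = Dl} (assume (t∀ a) hs) g =
  backL Dl (_ ∷ []) (∀L t (frontL Dl (_ ∷ [])
    (ih (assume (translation-subst (single t) a) hs) g)))
sound-∀L t ih {Dr = Dr} (deny (r∀¬ a) hs) g =
  backR Dr (_ ∷ []) (∃R t (frontR Dr (_ ∷ [])
    (ih (deny (r¬ (translation-subst (single t) a)) hs) g)))

sound-∀R : Sound (↑s Γ) (just F) → Sound Γ (just (∀' F))
sound-∀R ih hs (prove (t∀ a))   = ∀R (ih (hyps-shift hs) (prove a))
sound-∀R ih hs (refute (r∀¬ a)) = ∃L (ih (hyps-shift hs) (refute (r¬ a)))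

sound-∃L : Sound (F ∷ ↑s Γ) (↑m D) → Sound (∃' F ∷ Γ) D
sound-∃L ih {_ ∷ L} {R} {Dl} {Dr} (assume (t∃ a) hs) g =
  backL Dl (_ ∷ []) (∃L (subst₂ (λ Γ Δ → _ ∷ Γ ⊢K Δ) (sym (map-++ ↑ Dl L)) (sym (map-++ ↑ Dr R))
    (frontL (↑s Dl) (_ ∷ []) (ih (assume a (hyps-shift hs)) (goal-shift g)))))

sound-∃R : ∀ t → Sound Γ (just (F [ t ])) → Sound Γ (just (∃' F))
sound-∃R t ih hs (prove (t∃ a)) = ∃R t (ih hs (prove (translation-subst (single t) a)))

sound : Γ ⊢J D → Sound Γ D
sound ax          = sound-ax
sound (exch p d)  = sound-exch p (sound d)
sound (contrL d)  = sound-contrL (sound d)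
sound (weakL d)   = sound-weakL (sound d)
sound (weakR d)   = sound-weakR (sound d)
sound (∧L d)      = sound-∧L (sound d)
sound (∧R d e)    = sound-∧R (sound d) (sound e)
sound (∨L d e)    = sound-∨L (sound d) (sound e)
sound (∨R₁ d)     = sound-∨R₁ (sound d)
sound (∨R₂ d)     = sound-∨R₂ (sound d)
sound (⇒L d e)    = sound-⇒L (sound d) (sound e)
sound (⇒R d)      = sound-⇒R (sound d)
sound (¬L d)      = sound-¬L (sound d)
sound (¬R d)      = sound-¬R (sound d)
sound (∀L t d)    = sound-∀L t (sound d)
sound (∀R d)      = sound-∀R (sound d)
sound (∃L d)      = sound-∃L (sound d)
sound (∃R t d)    = sound-∃R t (sound d)

assume-positive : ∀ Γ → Hyps Γ′ [] R → Hyps (Γ ᵖˢ ++ Γ′) Γ R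
assume-positive []      hs = hs
assume-positive (A ∷ Γ) hs = assume (ᵖ-translation A) (assume-positive Γ hs)

deny-antinegated : All (λ A → ¬ IsNeg A) Δ → Hyps Γ′ [] R →
                   Hyps (⌟ˢ (Δ ⁿˢ) ++ Γ′) [] (Δ ++ R)
deny-antinegated []                   hs = hs
deny-antinegated (_∷_ {A} noNeg rest) hs =
  deny (antineg-refutation A noNeg) (deny-antinegated rest hs)

deny-negated : ∀ Δ → Hyps (¬ˢ (Δ ⁿˢ)) [] Δ
deny-negated []      = []
deny-negated (A ∷ Δ) = deny (r¬ (ⁿ-translation A)) (deny-negated Δ)

goal-negative : ∀ D → Goal (D ⁿᵐ) [] (toList D)
goal-negative nothing  = none
goal-negative (just A) = prove (ⁿ-translation A)

theorem4 : (Γ Δ₁ Δ₂ : List Formula) (D : Maybe Formula) →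
           All (λ A → ¬ IsNeg A) Δ₁ →
           (Γ ᵖˢ ++ ⌟ˢ (Δ₁ ⁿˢ) ++ ¬ˢ (Δ₂ ⁿˢ)) ⊢J (D ⁿᵐ) →
           Γ ⊢K (Δ₁ ++ Δ₂ ++ toList D)
theorem4 Γ Δ₁ Δ₂ D noNeg d = exch refl goal-last (sound d hyps (goal-negative D))
  where
  hyps : Hyps (Γ ᵖˢ ++ ⌟ˢ (Δ₁ ⁿˢ) ++ ¬ˢ (Δ₂ ⁿˢ)) Γ (Δ₁ ++ Δ₂)
  hyps = assume-positive Γ (deny-antinegated noNeg (deny-negated Δ₂))

  goal-last : toList D ++ Δ₁ ++ Δ₂ ↭ Δ₁ ++ Δ₂ ++ toList D
  goal-last =
    trans (++-comm (toList D) (Δ₁ ++ Δ₂)) (↭-reflexive (++-assoc Δ₁ Δ₂ (toList D)))
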